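{- For every prime number $p$, the integer \[Y(p):=\frac{1}{3}\left( (1+\sqrt{3}) \left( 2+\sqrt{3} \right)^{2p}+(1-\sqrt{3}) \left( 2-\sqrt{3} \right)^{2p}+1 \right)\] is composite. -}

module Defs where

open import Data.Nat using (ℕ; zero; suc)
open import Data.Integer using (ℤ; +_; -_) renaming (_+_ to _+ℤ_; _*_ to _*ℤ_)

record ℤ√3 : Set where
  constructor _+_√3
  field
    re : ℤ
    im : ℤ
open ℤ√3 public

infixl 6 _⊕_
infixl 7 _⊗_
infixr 8 _^^_

_⊕_ : ℤ√3 → ℤ√3 → ℤ√3
(a + b √3) ⊕ (c + d √3) = (a +ℤ c) + (b +ℤ d) √3

_⊗_ : ℤ√3 → ℤ√3 → ℤ√3
(a + b √3) ⊗ (c + d √3) = (a *ℤ c +ℤ (+ 3) *ℤ (b *ℤ d)) + (a *ℤ d +ℤ b *ℤ c) √3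

one : ℤ√3
one = (+ 1) + (+ 0) √3

_^^_ : ℤ√3 → ℕ → ℤ√3
x ^^ zero = one
x ^^ suc n = x ⊗ (x ^^ n)

threeY : ℕ → ℤ√3
threeY p =
  ((+ 1) + (+ 1) √3) ⊗ (((+ 2) + (+ 1) √3) ^^ (2 Data.Nat.* p))
  ⊕ ((+ 1) + (- (+ 1)) √3) ⊗ (((+ 2) + (- (+ 1)) √3) ^^ (2 Data.Nat.* p))
  ⊕ one

module Submission where

-- Write X = 2 + √3 and α = 1 + √3, and let w̄ denote the Galois conjugate
-- a - b√3 of w = a + b√3.  Since the second summand of 3·Y(p) is the conjugate
-- of the first, 3·Y(p) = w + w̄ + 1 with w = α·X^{2p}; in particular it is a
-- rational integer, namely 2·re(w) + 1.
--
-- Writing X^{2p} = (7 + 4√3)^p = (3k + 1) + b√3, the pair (k, b) of natural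
-- numbers is obtained from (0, 0) by p applications of the affine map
-- step(k, b) = (7k + 4b + 2, 12k + 7b + 4), and then Y(p) = 2k + 2b + 1.
-- This is the module Recurrence; the module ClosedForm verifies the
-- identification inside ℤ[√3].
--
-- Affine maps with
-- natural coefficients preserve congruences, and six steps bring (0, 0) back
-- to (0, 0) modulo 39; hence Y(6j + r) ≡ Y(r) (mod 39).  As Y(1) = 13 and
-- Y(5) = 3·159119, every prime p ≡ 1 (mod 6) gives 13 ∣ Y(p) and every
-- p ≡ 5 (mod 6) gives 3 ∣ Y(p); together with Y(2) = 3·59, Y(3) = 23·107 and
-- the growth Y(p) < Y(p + 1), this makes Y(p) composite for every prime p.

module Recurrence where

  open import Data.Nat using (ℕ; zero; suc; _+_; _*_)
  open import Data.Product using (_×_; _,_)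

  -- One multiplication by (2 + √3)² = 7 + 4√3, in the coordinates (k, b)
  -- of the number (3k + 1) + b√3.
  step : ℕ × ℕ → ℕ × ℕ
  step (k , b) = 7 * k + 4 * b + 2 , 12 * k + 7 * b + 4

  -- The coordinates of (2 + √3)^{2p}.
  state : ℕ → ℕ × ℕ
  state zero    = 0 , 0
  state (suc p) = step (state p)

  weight : ℕ × ℕ → ℕ
  weight (k , b) = 2 * k + 2 * b + 1

  Y : ℕ → ℕ
  Y p = weight (state p)

module ClosedForm where

  open import Defs
  open Recurrence using (step; state; weight; Y)
  open import Data.Nat using (ℕ; zero; suc)
  import Data.Nat as ℕ
  import Data.Nat.Properties as ℕ
  open import Data.Integer using (+_; -_; _+_; _*_)
  open import Data.Integer.Properties using (pos-+; pos-*; +-identityʳ; +-inverseʳ)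
  open import Data.Integer.Tactic.RingSolver using (solve-∀)
  open import Data.Product using (_×_; _,_; proj₁; proj₂)
  open import Relation.Binary.PropositionalEquality
  open ≡-Reasoning

  X α : ℤ√3
  X = (+ 2) + (+ 1) √3
  α = (+ 1) + (+ 1) √3

  conj : ℤ√3 → ℤ√3
  conj (a + b √3) = a + (- b) √3

  ⊗-assoc : ∀ x y z → (x ⊗ y) ⊗ z ≡ x ⊗ (y ⊗ z)
  ⊗-assoc (a + b √3) (c + d √3) (e + f √3) =
    cong₂ _+_√3 (assoc-re a b c d e f) (assoc-im a b c d e f)
    where
    assoc-re : ∀ a b c d e f →
      (a * c + + 3 * (b * d)) * e + + 3 * ((a * d + b * c) * f)
        ≡ a * (c * e + + 3 * (d * f)) + + 3 * (b * (c * f + d * e))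
    assoc-re = solve-∀
    assoc-im : ∀ a b c d e f →
      (a * c + + 3 * (b * d)) * f + (a * d + b * c) * e
        ≡ a * (c * f + d * e) + b * (c * e + + 3 * (d * f))
    assoc-im = solve-∀

  conj-⊗ : ∀ x y → conj (x ⊗ y) ≡ conj x ⊗ conj y
  conj-⊗ (a + b √3) (c + d √3) = cong₂ _+_√3 (conj-re a b c d) (conj-im a b c d)
    where
    conj-re : ∀ a b c d → a * c + + 3 * (b * d) ≡ a * c + + 3 * (- b * - d)
    conj-re = solve-∀
    conj-im : ∀ a b c d → - (a * d + b * c) ≡ a * - d + - b * c
    conj-im = solve-∀

  conj-^^ : ∀ x n → conj (x ^^ n) ≡ conj x ^^ n
  conj-^^ x zero    = refl
  conj-^^ x (suc n) = trans (conj-⊗ x (x ^^ n)) (cong (conj x ⊗_) (conj-^^ x n))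

  ^^-double : ∀ x n → x ^^ (2 ℕ.* n) ≡ (x ⊗ x) ^^ n
  ^^-double x zero    = refl
  ^^-double x (suc n) = begin
    x ^^ (2 ℕ.* suc n)        ≡⟨ cong (x ^^_) (ℕ.*-suc 2 n) ⟩
    x ⊗ (x ⊗ x ^^ (2 ℕ.* n))  ≡⟨ sym (⊗-assoc x x _) ⟩
    (x ⊗ x) ⊗ x ^^ (2 ℕ.* n)  ≡⟨ cong ((x ⊗ x) ⊗_) (^^-double x n) ⟩
    (x ⊗ x) ⊗ (x ⊗ x) ^^ n    ∎

  +-affine : ∀ a b c k m →
    + (a ℕ.* k ℕ.+ b ℕ.* m ℕ.+ c) ≡ + a * + k + + b * + m + + c
  +-affine a b c k m = begin
    + (a ℕ.* k ℕ.+ b ℕ.* m ℕ.+ c)       ≡⟨ pos-+ (a ℕ.* k ℕ.+ b ℕ.* m) c ⟩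
    + (a ℕ.* k ℕ.+ b ℕ.* m) + + c       ≡⟨ cong (_+ + c) (pos-+ (a ℕ.* k) (b ℕ.* m)) ⟩
    + (a ℕ.* k) + + (b ℕ.* m) + + c     ≡⟨ cong₂ (λ u v → u + v + + c) (pos-* a k) (pos-* b m) ⟩
    + a * + k + + b * + m + + c         ∎

  shape : ℕ × ℕ → ℤ√3
  shape (k , b) = (+ 3 * + k + + 1) + (+ b) √3

  X²-step : ∀ s → (X ⊗ X) ⊗ shape s ≡ shape (step s)
  X²-step (k , b) = cong₂ _+_√3
    (trans (step-re (+ k) (+ b)) (cong (λ t → + 3 * t + + 1) (sym (+-affine 7 4 2 k b))))
    (trans (step-im (+ k) (+ b)) (sym (+-affine 12 7 4 k b)))
    where
    step-re : ∀ K B →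
      + 7 * (+ 3 * K + + 1) + + 3 * (+ 4 * B) ≡ + 3 * (+ 7 * K + + 4 * B + + 2) + + 1
    step-re = solve-∀
    step-im : ∀ K B → + 7 * B + + 4 * (+ 3 * K + + 1) ≡ + 12 * K + + 7 * B + + 4
    step-im = solve-∀

  X-power : ∀ p → X ^^ (2 ℕ.* p) ≡ shape (state p)
  X-power p = trans (^^-double X p) (X²-power p)
    where
    X²-power : ∀ p → (X ⊗ X) ^^ p ≡ shape (state p)
    X²-power zero    = refl
    X²-power (suc p) = trans (cong ((X ⊗ X) ⊗_) (X²-power p)) (X²-step (state p))

  T : ℤ√3 → ℤ√3
  T w = w ⊕ conj w ⊕ one

  im-T : ∀ w → im (T w) ≡ + 0
  im-T w = trans (+-identityʳ _) (+-inverseʳ (im w))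

  -- 3·Y(p) = T(α·X^{2p}): the second summand is the conjugate of the first.
  threeY-T : ∀ p → threeY p ≡ T (α ⊗ X ^^ (2 ℕ.* p))
  threeY-T p = cong (λ v → α ⊗ X ^^ n ⊕ v ⊕ one) (begin
    conj α ⊗ conj X ^^ n     ≡⟨ cong (conj α ⊗_) (sym (conj-^^ X n)) ⟩
    conj α ⊗ conj (X ^^ n)   ≡⟨ sym (conj-⊗ α (X ^^ n)) ⟩
    conj (α ⊗ X ^^ n)        ∎)
    where
    n : ℕ
    n = 2 ℕ.* p

  re-T-shape : ∀ k b → re (T (α ⊗ shape (k , b))) ≡ + 3 * + weight (k , b)
  re-T-shape k b =
    trans (T-re (+ k) (+ b)) (cong (+ 3 *_) (sym (+-affine 2 2 1 k b)))
    where
    T-re : ∀ K B →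
      (+ 1 * (+ 3 * K + + 1) + + 3 * (+ 1 * B)) + (+ 1 * (+ 3 * K + + 1) + + 3 * (+ 1 * B)) + + 1
        ≡ + 3 * (+ 2 * K + + 2 * B + + 1)
    T-re = solve-∀

  re-threeY : ∀ p → re (threeY p) ≡ + 3 * + Y p
  re-threeY p = begin
    re (threeY p)                    ≡⟨ cong re (threeY-T p) ⟩
    re (T (α ⊗ X ^^ (2 ℕ.* p)))      ≡⟨ cong (λ u → re (T (α ⊗ u))) (X-power p) ⟩
    re (T (α ⊗ shape (state p)))     ≡⟨ re-T-shape (proj₁ (state p)) (proj₂ (state p)) ⟩
    + 3 * + Y p                      ∎

  im-threeY : ∀ p → im (threeY p) ≡ + 0
  im-threeY p = trans (cong im (threeY-T p)) (im-T (α ⊗ X ^^ (2 ℕ.* p)))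

module Compositeness where

  open Recurrence using (step; state; weight; Y)
  open import Data.Nat
  open import Data.Nat.Properties
  open import Data.Nat.DivMod using (_%_; _/_; m%n<n; m≡m%n+[m/n]*n)
  open import Data.Nat.Divisibility using (_∣_; divides; ∣-refl; ∣-trans; _∣0; n∣m*n; ∣m∣n⇒∣m+n)
  open import Data.Nat.Primality using (Prime; Composite; composite; prime⇒irreducible; ¬prime[1])
  open import Data.Nat.Tactic.RingSolver using (solve-∀)
  open import Data.Product using (_×_; _,_; ∃-syntax)
  open import Data.Sum using (_⊎_; inj₁; inj₂)
  open import Relation.Nullary using (contradiction)
  open import Relation.Nullary.Decidable using (toWitness)
  open import Relation.Binary.PropositionalEquality

  infix 4 _≼⟨_⟩_ _≼²⟨_⟩_

  -- a ≼⟨ d ⟩ b : b = m·d + a for some m, i.e. b ≡ a (mod d) with a ≤ b.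
  _≼⟨_⟩_ : ℕ → ℕ → ℕ → Set
  a ≼⟨ d ⟩ b = ∃[ m ] b ≡ m * d + a

  ≼-refl : ∀ {a d} → a ≼⟨ d ⟩ a
  ≼-refl = 0 , refl

  ≼-trans : ∀ {a b c d} → a ≼⟨ d ⟩ b → b ≼⟨ d ⟩ c → a ≼⟨ d ⟩ c
  ≼-trans {a} {d = d} (m , refl) (n , refl) =
    n + m , trans (sym (+-assoc (n * d) (m * d) a)) (cong (_+ a) (sym (*-distribʳ-+ d n m)))

  ≼⇒≤ : ∀ {a b d} → a ≼⟨ d ⟩ b → a ≤ b
  ≼⇒≤ (m , refl) = m≤n+m _ (m * _)

  ≼-∣ : ∀ {e d a b} → e ∣ d → e ∣ a → a ≼⟨ d ⟩ b → e ∣ b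
  ≼-∣ e∣d e∣a (m , refl) = ∣m∣n⇒∣m+n (∣-trans e∣d (n∣m*n m)) e∣a

  affine-≼ : ∀ {x x′ y y′ d} (α β γ : ℕ) → x ≼⟨ d ⟩ x′ → y ≼⟨ d ⟩ y′ →
    α * x + β * y + γ ≼⟨ d ⟩ α * x′ + β * y′ + γ
  affine-≼ {x} {_} {y} {_} {d} α β γ (m , refl) (n , refl) =
    α * m + β * n , shift α β γ x y m n d
    where
    shift : ∀ α β γ x y m n d →
      α * (m * d + x) + β * (n * d + y) + γ ≡ (α * m + β * n) * d + (α * x + β * y + γ)
    shift = solve-∀

  _≼²⟨_⟩_ : ℕ × ℕ → ℕ → ℕ × ℕ → Set
  (k , b) ≼²⟨ d ⟩ (k′ , b′) = k ≼⟨ d ⟩ k′ × b ≼⟨ d ⟩ b′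

  ≼²-trans : ∀ {s t u d} → s ≼²⟨ d ⟩ t → t ≼²⟨ d ⟩ u → s ≼²⟨ d ⟩ u
  ≼²-trans (p , q) (p′ , q′) = ≼-trans p p′ , ≼-trans q q′

  step-≼ : ∀ {s t d} → s ≼²⟨ d ⟩ t → step s ≼²⟨ d ⟩ step t
  step-≼ (p , q) = affine-≼ 7 4 2 p q , affine-≼ 12 7 4 p q

  weight-≼ : ∀ {s t d} → s ≼²⟨ d ⟩ t → weight s ≼⟨ d ⟩ weight t
  weight-≼ (p , q) = affine-≼ 2 2 1 p q

  -- Six steps return to the start modulo 39: state 6 = (39·31200, 39·54040).
  state-shift : ∀ n → state n ≼²⟨ 39 ⟩ state (6 + n)
  state-shift zero    = (31200 , refl) , (54040 , refl)
  state-shift (suc n) = step-≼ (state-shift n)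

  state-period : ∀ r j → state r ≼²⟨ 39 ⟩ state (j * 6 + r)
  state-period r zero    = ≼-refl , ≼-refl
  state-period r (suc j) = ≼²-trans (state-period r j) (state-shift (j * 6 + r))

  Y-period : ∀ r j → Y r ≼⟨ 39 ⟩ Y (j * 6 + r)
  Y-period r j = weight-≼ (state-period r j)

  Y-increasing : ∀ p → Y p < Y (suc p)
  Y-increasing p with state p
  ... | k , b = subst (suc (weight (k , b)) ≤_) (sym (growth k b)) (m≤m+n _ _)
    where
    growth : ∀ k b →
      2 * (7 * k + 4 * b + 2) + 2 * (12 * k + 7 * b + 4) + 1
        ≡ suc (2 * k + 2 * b + 1) + (36 * k + 20 * b + 11)
    growth = solve-∀

  -- Since Y(1) = 13 and Y is increasing, Y(p) > 13 for p ≥ 2.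
  13<Y : ∀ q → 13 < Y (2 + q)
  13<Y zero    = Y-increasing 1
  13<Y (suc q) = <-trans (13<Y q) (Y-increasing (2 + q))

  3<Y : ∀ q → 3 < Y (2 + q)
  3<Y q = <-trans (s<s (s<s (s<s z<s))) (13<Y q)

  prime-residues : ∀ {p} → Prime p → p ≡ 2 ⊎ p ≡ 3 ⊎ 1 ≼⟨ 6 ⟩ p ⊎ 5 ≼⟨ 6 ⟩ p
  prime-residues {p} pr = classify (p % 6) (m%n<n p 6)
    (p / 6 , trans (m≡m%n+[m/n]*n p 6) (+-comm (p % 6) _))
    where
    forced : ∀ {d r} → 1 < d → d ∣ 6 → d ∣ r → r ≼⟨ 6 ⟩ p → p ≡ d
    forced 1<d d∣6 d∣r r≼p with prime⇒irreducible pr (≼-∣ d∣6 d∣r r≼p)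
    ... | inj₁ refl = contradiction refl (<⇒≢ 1<d)
    ... | inj₂ d≡p  = sym d≡p

    classify : ∀ r → r < 6 → r ≼⟨ 6 ⟩ p → p ≡ 2 ⊎ p ≡ 3 ⊎ 1 ≼⟨ 6 ⟩ p ⊎ 5 ≼⟨ 6 ⟩ p
    classify 0 _ r≼p = inj₁ (forced (s<s z<s) (divides 3 refl) (2 ∣0) r≼p)
    classify 1 _ r≼p = inj₂ (inj₂ (inj₁ r≼p))
    classify 2 _ r≼p = inj₁ (forced (s<s z<s) (divides 3 refl) ∣-refl r≼p)
    classify 3 _ r≼p = inj₂ (inj₁ (forced (s<s z<s) (divides 2 refl) ∣-refl r≼p))
    classify 4 _ r≼p = inj₁ (forced (s<s z<s) (divides 3 refl) (divides 2 refl) r≼p)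
    classify 5 _ r≼p = inj₂ (inj₂ (inj₂ r≼p))
    classify (suc (suc (suc (suc (suc (suc _)))))) (s<s (s<s (s<s (s<s (s<s (s<s ())))))) _

  -- Y(2) = 59·3 and Y(3) = 107·23; for p ≡ 1 (mod 6) the divisor is 13 = Y(1),
  -- and for p ≡ 5 (mod 6) it is 3, which divides Y(5) = 159119·3.
  Y-composite : ∀ {p} → Prime p → Composite (Y p)
  Y-composite pr with prime-residues pr
  ... | inj₁ refl                          = composite {3} (3<Y 0) (divides 59 refl)
  ... | inj₂ (inj₁ refl)                   = composite {23} (toWitness {a? = 23 <? Y 3} _) (divides 107 refl)
  ... | inj₂ (inj₂ (inj₁ (zero , refl)))   = contradiction pr ¬prime[1]
  ... | inj₂ (inj₂ (inj₁ (suc j , refl)))  =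
    composite {13} (13<Y (4 + (j * 6 + 1))) (≼-∣ (divides 3 refl) ∣-refl (Y-period 1 (suc j)))
  ... | inj₂ (inj₂ (inj₂ (j , refl)))      =
    composite {3} (<-≤-trans (3<Y 3) (≼⇒≤ (Y-period 5 j))) (≼-∣ (divides 13 refl) (divides 159119 refl) (Y-period 5 j))

open import Defs
open import Data.Nat using (ℕ)
open import Data.Nat.Primality using (Prime; Composite)
open import Data.Integer using (+_; _*_)
open import Data.Product using (∃-syntax; _×_; _,_)
open import Relation.Binary.PropositionalEquality using (_≡_)
open Recurrence using (Y)
open ClosedForm using (re-threeY; im-threeY)
open Compositeness using (Y-composite)

theorem1 : (p : ℕ) → Prime p →
    ∃[ y ] (re (threeY p) ≡ (+ 3) * (+ y) × im (threeY p) ≡ + 0 × Composite y)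
theorem1 p pr = Y p , re-threeY p , im-threeY p , Y-composite pr
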